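{- Let $F$ be a nice forest. Then, for every set $W$ of $|E(F)|$ distinct strictly positive integers, there exists an edge-injective neighbour-sum-distinguishing $W$-edge-weighting of $F$. In particular, $\chi^{e,1}_\Sigma(F)=|E(F)|$.
   Context: All graphs are finite, simple, undirected and loopless. A graph is nice if none of its connected components is isomorphic to $K_2$. For a set $W$ of weights, a $W$-edge-weighting of a graph $G$ is a map $w:E(G)\to W$; a $k$-edge-weighting is a $\{1,\dots,k\}$-edge-weighting. For an edge-weighting $w$ and a vertex $v$, $\sigma_w(v)=\sum_{u\in N(v)} w(vu)$. The weighting $w$ is neighbour-sum-distinguishing if $\sigma_w(u)\neq\sigma_w(v)$ for every edge $uv$, and edge-injective if no two distinct edges receive the same weight. For a nice graph $G$, $\chi^{e,1}_\Sigma(G)$ denotes the smallest $k$ such that $G$ admits an edge-injective neighbour-sum-distinguishing $k$-edge-weighting. -}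

module Defs where

open import Data.Nat using (ℕ; zero; suc; _+_; _<_; _≤_)
open import Data.Fin using (Fin; toℕ; inject₁; fromℕ; _≟_)
  renaming (zero to fzero; suc to fsuc; _<_ to _<ᶠ_)
open import Data.Product using (_×_; _,_; proj₁; proj₂; Σ; ∃)
open import Data.Sum using (_⊎_)
open import Data.List using (List; length; lookup; tabulate)
open import Data.Nat.ListAction using (sum)
open import Data.List.Membership.Propositional using (_∈_)
open import Data.List.Relation.Unary.All using (All)
open import Data.List.Relation.Unary.Unique.Propositional using (Unique)
open import Relation.Binary.PropositionalEquality using (_≡_; _≢_)
open import Relation.Nullary using (¬_; yes; no)
open import Function.Definitions using (Injective)

-- A finite simple graph on vertex set Fin n, given by its list of edges.
-- Each edge {u,v} is stored once as the ordered pair (u , v) with u < v,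
-- and no edge is listed twice.
record Graph (n : ℕ) : Set where
  field
    edges   : List (Fin n × Fin n)
    ordered : All (λ e → proj₁ e <ᶠ proj₂ e) edges
    nodup   : Unique edges
open Graph public

∣E∣ : ∀ {n} → Graph n → ℕ
∣E∣ G = length (edges G)

edge : ∀ {n} (G : Graph n) → Fin (∣E∣ G) → Fin n × Fin n
edge G e = lookup (edges G) e

Adj : ∀ {n} → Graph n → Fin n → Fin n → Set
Adj G u v = ((u , v) ∈ edges G) ⊎ ((v , u) ∈ edges G)

record Cycle {n} (G : Graph n) : Set where
  field
    k      : ℕ
    c      : Fin (3 + k) → Fin n
    inj    : Injective _≡_ _≡_ c
    steps  : ∀ (i : Fin (2 + k)) → Adj G (c (inject₁ i)) (c (fsuc i))
    closes : Adj G (c (fromℕ (2 + k))) (c fzero)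

Forest : ∀ {n} → Graph n → Set
Forest G = ¬ Cycle G

-- A connected component isomorphic to K₂ is exactly an edge uv such that
-- u has no neighbour other than v and v has no neighbour other than u.
HasK2Component : ∀ {n} → Graph n → Set
HasK2Component {n} G =
  Σ (Fin n × Fin n) λ e → (e ∈ edges G)
    × (∀ x → Adj G (proj₁ e) x → x ≡ proj₂ e)
    × (∀ x → Adj G (proj₂ e) x → x ≡ proj₁ e)

Nice : ∀ {n} → Graph n → Set
Nice G = ¬ HasK2Component G

Weighting : ∀ {n} → Graph n → Set
Weighting G = Fin (∣E∣ G) → ℕ

contrib : ∀ {n} (G : Graph n) → Weighting G → Fin n → Fin (∣E∣ G) → ℕ
contrib G w v e with v ≟ proj₁ (edge G e) | v ≟ proj₂ (edge G e)
... | yes _ | _     = w e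
... | no _  | yes _ = w e
... | no _  | no _  = 0

σ : ∀ {n} (G : Graph n) → Weighting G → Fin n → ℕ
σ G w v = sum (tabulate (contrib G w v))

NeighbourSumDistinguishing : ∀ {n} (G : Graph n) → Weighting G → Set
NeighbourSumDistinguishing G w =
  ∀ e → σ G w (proj₁ (edge G e)) ≢ σ G w (proj₂ (edge G e))

EdgeInjective : ∀ {n} (G : Graph n) → Weighting G → Set
EdgeInjective G w = Injective _≡_ _≡_ w

UsesWeights : ∀ {n} (G : Graph n) → List ℕ → Weighting G → Set
UsesWeights G W w = ∀ e → w e ∈ W

IsKWeighting : ∀ {n} (G : Graph n) → ℕ → Weighting G → Set
IsKWeighting G k w = ∀ e → (1 ≤ w e) × (w e ≤ k)

AdmitsEI-NSD : ∀ {n} → Graph n → ℕ → Set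
AdmitsEI-NSD G k = Σ (Weighting G) λ w →
  IsKWeighting G k w × EdgeInjective G w × NeighbourSumDistinguishing G w

IsChiE1 : ∀ {n} → Graph n → ℕ → Set
IsChiE1 G k = AdmitsEI-NSD G k × (∀ k′ → k′ < k → ¬ AdmitsEI-NSD G k′)

-- The end of a longest path of a nice forest yields a vertex v
-- with at least one leaf neighbour, all of whose neighbours are leaves except possibly one, the
-- anchor p. If p is a leaf too, the component is a star: remove it, weight the rest by induction
-- and give the star the remaining weights; each leaf then sees only its own weight, which is less
-- than the sum at v. Otherwise remove the k leaf edges at v (v becomes a leaf of p) and weight the
-- rest by induction with all weights but a set S of k of them, assigned to the leaf edges. Then
-- σ(v) = ΣS + w(vp) and σ(p) = w(vp) + (the sum of the d other weights at p), and choosing S to be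
-- the k smallest weights if k ≤ d and the k largest otherwise makes σ(v) ≠ σ(p).
module Submission where

open import Defs
open import Data.Nat using (ℕ; _<_)
open import Data.Product using (_×_; Σ)
open import Data.List using (List; length)
open import Data.List.Membership.Propositional using (_∈_)
open import Data.List.Relation.Unary.All using (All)
open import Data.List.Relation.Unary.Unique.Propositional using (Unique)
open import Relation.Binary.PropositionalEquality using (_≡_)

import Data.Nat.Properties as NP
open import Algebra.Properties.CommutativeSemigroup NP.+-commutativeSemigroup using (x∙yz≈y∙xz)
open import Data.Empty using (⊥; ⊥-elim)
open import Data.Fin using (Fin; inject₁; fromℕ; fromℕ<; toℕ) renaming (zero to fzero; suc to fsuc)
import Data.Fin.Properties as FP
open import Data.List using ([]; _∷_; _++_; filter; map; lookup; take; drop; tabulate; upTo)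
import Data.List.Properties as LP
open import Data.List.Membership.Propositional using (lose)
import Data.List.Membership.Propositional.Properties as MP
import Data.List.Membership.DecPropositional as DecMembership
import Data.List.Relation.Unary.All as All
import Data.List.Relation.Unary.All.Properties as AllP
open import Data.List.Relation.Unary.AllPairs using (AllPairs; []; _∷_)
import Data.List.Relation.Unary.AllPairs as AllPairs
open import Data.List.Relation.Unary.Any using (here; there)
import Data.List.Relation.Unary.Any as Any
open import Data.List.Relation.Unary.Linked using (Linked; [-]; _∷_)
import Data.List.Relation.Unary.Linked as Linked
import Data.List.Relation.Unary.Linked.Properties as LinkedP
import Data.List.Relation.Unary.Unique.Propositional.Properties as UniqueP
open import Data.List.Relation.Binary.Permutation.Propositional using (↭-sym; ↭⇒↭ₛ)
import Data.List.Relation.Binary.Permutation.Propositional.Properties as PermP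
import Data.List.Relation.Binary.Permutation.Setoid.Properties as PermS
open import Data.List.Sort NP.≤-decTotalOrder using (sort; sort-↭; sort-↗)
open import Data.Nat using (zero; suc; _+_; _≤_; z≤n; s≤s; _∸_; _≤?_)
open import Data.Nat.Induction using (<-wellFounded)
open import Data.Nat.ListAction using (sum)
open import Data.Product using (∃; _,_; proj₁; proj₂)
import Data.Product.Properties as PP
open import Data.Sum using (_⊎_; inj₁; inj₂)
import Data.Sum as Sum
open import Function using (_∘_)
open import Function.Definitions using (Injective)
import Induction.WellFounded as WF
open import Level using (0ℓ)
import Relation.Binary.Construct.On as On
open import Relation.Binary.Definitions using (DecidableEquality)
open import Relation.Binary.PropositionalEquality
  using (_≢_; refl; sym; trans; cong; cong₂; subst; subst₂; setoid; module ≡-Reasoning)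
open import Relation.Nullary using (¬_; Dec; yes; no; ¬?)
open import Relation.Nullary.Decidable using (_×-dec_; _⊎-dec_; decidable-stable)
open import Relation.Unary using (Decidable)

module _ {A : Set} where

  sum-map-filter : {P : A → Set} (P? : Decidable P) (f : A → ℕ) (xs : List A) →
    sum (map f xs) ≡ sum (map f (filter P? xs)) + sum (map f (filter (¬? ∘ P?) xs))
  sum-map-filter P? f [] = refl
  sum-map-filter P? f (x ∷ xs) with P? x
  ... | yes _ = trans (cong (f x +_) (sum-map-filter P? f xs)) (sym (NP.+-assoc (f x) _ _))
  ... | no _  = trans (cong (f x +_) (sum-map-filter P? f xs)) (x∙yz≈y∙xz (f x) (sum (map f (filter P? xs))) _)

  length-filter-split : {P : A → Set} (P? : Decidable P) (xs : List A) →
    length xs ≡ length (filter P? xs) + length (filter (¬? ∘ P?) xs)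
  length-filter-split P? [] = refl
  length-filter-split P? (x ∷ xs) with P? x
  ... | yes _ = cong suc (length-filter-split P? xs)
  ... | no _  = trans (cong suc (length-filter-split P? xs)) (sym (NP.+-suc _ _))

  sum-map-cong : {f g : A → ℕ} {xs : List A} → (∀ {x} → x ∈ xs → f x ≡ g x) →
    sum (map f xs) ≡ sum (map g xs)
  sum-map-cong f≗g = cong sum (LP.map-cong-local (All.tabulate f≗g))

  sum-map-zero : (f : A → ℕ) {xs : List A} → (∀ {x} → x ∈ xs → f x ≡ 0) → sum (map f xs) ≡ 0
  sum-map-zero f {[]} f≡0 = refl
  sum-map-zero f {x ∷ xs} f≡0 = cong₂ _+_ (f≡0 (here refl)) (sum-map-zero f (f≡0 ∘ there))

  sum-map-≥ : (f : A → ℕ) {x : A} {xs : List A} → x ∈ xs → f x ≤ sum (map f xs)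
  sum-map-≥ f {xs = y ∷ xs} (here refl) = NP.m≤m+n (f y) _
  sum-map-≥ f {xs = y ∷ xs} (there x∈) = NP.≤-trans (sum-map-≥ f x∈) (NP.m≤n+m _ (f y))

  sum-map-≥-pair : (f : A → ℕ) {x y : A} {xs : List A} → x ∈ xs → y ∈ xs → x ≢ y →
    f x + f y ≤ sum (map f xs)
  sum-map-≥-pair f (here refl) (here refl) x≢y = ⊥-elim (x≢y refl)
  sum-map-≥-pair f (here refl) (there y∈) _ = NP.+-monoʳ-≤ _ (sum-map-≥ f y∈)
  sum-map-≥-pair f {x} {y} {_ ∷ xs} (there x∈) (here refl) _ =
    subst (_≤ f y + sum (map f xs)) (NP.+-comm (f y) (f x)) (NP.+-monoʳ-≤ (f y) (sum-map-≥ f x∈))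
  sum-map-≥-pair f {xs = z ∷ _} (there x∈) (there y∈) x≢y =
    NP.≤-trans (sum-map-≥-pair f x∈ y∈ x≢y) (NP.m≤n+m _ (f z))

  sum-map-singleton : (f : A → ℕ) {x : A} {xs : List A} → Unique xs → x ∈ xs →
    (∀ {y} → y ∈ xs → y ≡ x) → sum (map f xs) ≡ f x
  sum-map-singleton f (x∉ ∷ _) (here refl) only =
    trans (cong (f _ +_) (sum-map-zero f (λ y∈ → ⊥-elim (All.lookup x∉ y∈ (sym (only (there y∈)))))))
          (NP.+-identityʳ _)
  sum-map-singleton f (y∉ ∷ _) (there x∈) only = ⊥-elim (All.lookup y∉ x∈ (only (here refl)))

  lookup-injective : {xs : List A} → Unique xs → Injective _≡_ _≡_ (lookup xs)
  lookup-injective {_ ∷ _} _ {fzero} {fzero} _ = refl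
  lookup-injective {_ ∷ _} (x∉ ∷ _) {fzero} {fsuc j} eq = ⊥-elim (All.lookup x∉ (MP.∈-lookup j) eq)
  lookup-injective {_ ∷ _} (x∉ ∷ _) {fsuc i} {fzero} eq = ⊥-elim (All.lookup x∉ (MP.∈-lookup i) (sym eq))
  lookup-injective {_ ∷ _} (_ ∷ u) {fsuc i} {fsuc j} eq = cong fsuc (lookup-injective u eq)

  AllPairs-prefix : {R : A → A → Set} (xs : List A) {y : A} {ys : List A} →
    AllPairs R (xs ++ y ∷ ys) → AllPairs R (xs ++ y ∷ [])
  AllPairs-prefix [] (_ ∷ _) = All.[] ∷ []
  AllPairs-prefix (x ∷ xs) (rx ∷ rs) = prefix xs rx ∷ AllPairs-prefix xs rs
    where
    prefix : ∀ {P : A → Set} (xs : List A) {y ys} → All P (xs ++ y ∷ ys) → All P (xs ++ y ∷ [])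
    prefix [] (py All.∷ _) = py All.∷ All.[]
    prefix (_ ∷ xs) (px All.∷ ps) = px All.∷ prefix xs ps

  Linked-prefix : {R : A → A → Set} (xs : List A) {y : A} {ys : List A} →
    Linked R (xs ++ y ∷ ys) → Linked R (xs ++ y ∷ [])
  Linked-prefix [] _ = [-]
  Linked-prefix (x ∷ []) (r ∷ _) = r ∷ [-]
  Linked-prefix (x ∷ x′ ∷ xs) (r ∷ rs) = r ∷ Linked-prefix (x′ ∷ xs) rs

  lastOf : A → List A → A
  lastOf x [] = x
  lastOf _ (y ∷ ys) = lastOf y ys

  lastOf-∷ʳ : (x : A) (xs : List A) (y : A) → lastOf x (xs ++ y ∷ []) ≡ y
  lastOf-∷ʳ x [] y = refl
  lastOf-∷ʳ _ (x ∷ xs) y = lastOf-∷ʳ x xs y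

  lookup-fromℕ : (x : A) (xs : List A) → lookup (x ∷ xs) (fromℕ (length xs)) ≡ lastOf x xs
  lookup-fromℕ x [] = refl
  lookup-fromℕ _ (x ∷ xs) = lookup-fromℕ x xs

  Linked-lookup : {R : A → A → Set} (x : A) (xs : List A) → Linked R (x ∷ xs) →
    ∀ i → R (lookup (x ∷ xs) (inject₁ i)) (lookup (x ∷ xs) (fsuc i))
  Linked-lookup x (y ∷ ys) (r ∷ _) fzero = r
  Linked-lookup x (y ∷ ys) (_ ∷ rs) (fsuc i) = Linked-lookup y ys rs i

unique⇒length≤ : ∀ {n} {xs : List (Fin n)} → Unique xs → length xs ≤ n
unique⇒length≤ u = FP.injective⇒≤ (lookup-injective u)

module _ {A : Set} (_≟_ : DecidableEquality A) where

  assign : List A → List ℕ → A → ℕ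
  assign [] _ _ = 0
  assign (_ ∷ _) [] _ = 0
  assign (k ∷ ks) (s ∷ ss) a with a ≟ k
  ... | yes _ = s
  ... | no _  = assign ks ss a

  assign-∈ : ∀ ks ss {a} → length ks ≡ length ss → a ∈ ks → assign ks ss a ∈ ss
  assign-∈ (k ∷ ks) (s ∷ ss) {a} eq a∈ with a ≟ k
  ... | yes _   = here refl
  ... | no a≢k  = there (assign-∈ ks ss (NP.suc-injective eq) (Any.tail a≢k a∈))

  assign-injective : ∀ ks ss {a b} → Unique ss → length ks ≡ length ss → a ∈ ks → b ∈ ks →
    assign ks ss a ≡ assign ks ss b → a ≡ b
  assign-injective (k ∷ ks) (s ∷ ss) {a} {b} (s∉ ∷ u) eq a∈ b∈ same with a ≟ k | b ≟ k
  ... | yes a≡k | yes b≡k = trans a≡k (sym b≡k)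
  ... | yes _   | no b≢k  =
    ⊥-elim (All.lookup s∉ (assign-∈ ks ss (NP.suc-injective eq) (Any.tail b≢k b∈)) same)
  ... | no a≢k  | yes _   =
    ⊥-elim (All.lookup s∉ (assign-∈ ks ss (NP.suc-injective eq) (Any.tail a≢k a∈)) (sym same))
  ... | no a≢k  | no b≢k  =
    assign-injective ks ss u (NP.suc-injective eq) (Any.tail a≢k a∈) (Any.tail b≢k b∈) same

  sum-map-assign : ∀ ks ss → Unique ks → length ks ≡ length ss → sum (map (assign ks ss) ks) ≡ sum ss
  sum-map-assign [] [] _ _ = refl
  sum-map-assign (k ∷ ks) (s ∷ ss) (k∉ ∷ u) eq with k ≟ k
  ... | no k≢k = ⊥-elim (k≢k refl)
  ... | yes _ = cong (s +_) (trans (sum-map-cong skip) (sum-map-assign ks ss u (NP.suc-injective eq)))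
    where
    skip : ∀ {a} → a ∈ ks → assign (k ∷ ks) (s ∷ ss) a ≡ assign ks ss a
    skip {a} a∈ with a ≟ k
    ... | yes a≡k = ⊥-elim (All.lookup k∉ a∈ (sym a≡k))
    ... | no _ = refl

sum-≤ : (xs ys : List ℕ) → length xs ≤ length ys → (∀ {x y} → x ∈ xs → y ∈ ys → x < y) →
  sum xs ≤ sum ys
sum-≤ [] ys _ _ = z≤n
sum-≤ (x ∷ xs) (y ∷ ys) (s≤s le) lt =
  NP.+-mono-≤ (NP.<⇒≤ (lt (here refl) (here refl))) (sum-≤ xs ys le (λ x∈ y∈ → lt (there x∈) (there y∈)))

sum-< : (xs ys : List ℕ) → length xs ≤ length ys → (∀ {x y} → x ∈ xs → y ∈ ys → x < y) →
  All (0 <_) ys → 0 < length ys → sum xs < sum ys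
sum-< [] (y ∷ ys) _ _ (0<y All.∷ _) _ = NP.<-≤-trans 0<y (NP.m≤m+n y _)
sum-< (x ∷ xs) (y ∷ ys) (s≤s le) lt _ _ =
  NP.+-mono-<-≤ (lt (here refl) (here refl)) (sum-≤ xs ys le (λ x∈ y∈ → lt (there x∈) (there y∈)))

AllPairs-++-cross : {A : Set} {R : A → A → Set} (xs ys : List A) → AllPairs R (xs ++ ys) →
  ∀ {x y} → x ∈ xs → y ∈ ys → R x y
AllPairs-++-cross (_ ∷ xs) ys (rx ∷ _) (here refl) y∈ = All.lookup rx (MP.∈-++⁺ʳ xs y∈)
AllPairs-++-cross (_ ∷ xs) ys (_ ∷ rs) (there x∈) y∈ = AllPairs-++-cross xs ys rs x∈ y∈

record Split (W : List ℕ) (i j : ℕ) : Set where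
  field
    lower upper  : List ℕ
    length-lower : length lower ≡ i
    length-upper : length upper ≡ j
    unique-lower : Unique lower
    unique-upper : Unique upper
    lower⊆W      : ∀ {x} → x ∈ lower → x ∈ W
    upper⊆W      : ∀ {x} → x ∈ upper → x ∈ W
    lower<upper  : ∀ {x y} → x ∈ lower → y ∈ upper → x < y

split : {W : List ℕ} → Unique W → ∀ i j → length W ≡ i + j → Split W i j
split {W} uW i j ∣W∣ = record
  { lower = take i ws
  ; upper = drop i ws
  ; length-lower = trans (LP.length-take i ws) (NP.m≤n⇒m⊓n≡m (subst (i ≤_) (sym ∣ws∣) (NP.m≤m+n i j)))
  ; length-upper = trans (LP.length-drop i ws) (trans (cong (_∸ i) ∣ws∣) (NP.m+n∸m≡n i j))
  ; unique-lower = UniqueP.take⁺ i unique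
  ; unique-upper = UniqueP.drop⁺ i unique
  ; lower⊆W = ∈W ∘ MP.∈-++⁺ˡ
  ; upper⊆W = ∈W ∘ MP.∈-++⁺ʳ (take i ws)
  ; lower<upper = AllPairs-++-cross (take i ws) (drop i ws) (subst (AllPairs _<_) (sym (LP.take++drop≡id i ws)) increasing)
  }
  where
  ws : List ℕ
  ws = sort W
  ∣ws∣ : length ws ≡ i + j
  ∣ws∣ = trans (PermP.↭-length (sort-↭ W)) ∣W∣
  unique : Unique ws
  unique = PermS.Unique-resp-↭ (setoid ℕ) (↭⇒↭ₛ (↭-sym (sort-↭ W))) uW
  increasing : AllPairs _<_ ws
  increasing = AllPairs.zipWith (λ (x≤y , x≢y) → NP.≤∧≢⇒< x≤y x≢y)
    (LinkedP.Linked⇒AllPairs NP.≤-trans (sort-↗ W) , unique)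
  ∈W : ∀ {x} → x ∈ take i ws ++ drop i ws → x ∈ W
  ∈W x∈ = PermP.∈-resp-↭ (sort-↭ W) (subst (_ ∈_) (LP.take++drop≡id i ws) x∈)

record Partition (W : List ℕ) (k m : ℕ) : Set where
  field
    part rest   : List ℕ
    length-part : length part ≡ k
    length-rest : length rest ≡ m
    unique-part : Unique part
    unique-rest : Unique rest
    part⊆W      : ∀ {x} → x ∈ part → x ∈ W
    rest⊆W      : ∀ {x} → x ∈ rest → x ∈ W
    disjoint    : ∀ {x y} → x ∈ part → y ∈ rest → x ≢ y

lower-partition : ∀ {W i j} → Split W i j → Partition W i j
lower-partition s = record
  { part = lower ; rest = upper ; length-part = length-lower ; length-rest = length-upper
  ; unique-part = unique-lower ; unique-rest = unique-upper ; part⊆W = lower⊆W ; rest⊆W = upper⊆W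
  ; disjoint = λ x∈ y∈ → NP.<⇒≢ (lower<upper x∈ y∈) }
  where open Split s

upper-partition : ∀ {W i j} → Split W i j → Partition W j i
upper-partition s = record
  { part = upper ; rest = lower ; length-part = length-upper ; length-rest = length-lower
  ; unique-part = unique-upper ; unique-rest = unique-lower ; part⊆W = upper⊆W ; rest⊆W = lower⊆W
  ; disjoint = λ x∈ y∈ → NP.>⇒≢ (lower<upper y∈ x∈) }
  where open Split s

module _ {n : ℕ} where

  Edge : Set
  Edge = Fin n × Fin n

  _≟ₑ_ : DecidableEquality Edge
  _≟ₑ_ = PP.≡-dec FP._≟_ FP._≟_

  adj? : (G : Graph n) (u v : Fin n) → Dec (Adj G u v)
  adj? G u v = ((u , v) ∈? edges G) ⊎-dec ((v , u) ∈? edges G)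
    where open DecMembership _≟ₑ_ using (_∈?_)

  Joins : Edge → Fin n → Fin n → Set
  Joins e a b = e ≡ (a , b) ⊎ e ≡ (b , a)

  Incident : Fin n → Edge → Set
  Incident v e = v ≡ proj₁ e ⊎ v ≡ proj₂ e

  incident? : (v : Fin n) (e : Edge) → Dec (Incident v e)
  incident? v e = (v FP.≟ proj₁ e) ⊎-dec (v FP.≟ proj₂ e)

  OtherNeighbour : Graph n → Fin n → Fin n → Set
  OtherNeighbour G c d = ∃ λ y → Adj G c y × y ≢ d

  otherNeighbour? : (G : Graph n) (c d : Fin n) → Dec (OtherNeighbour G c d)
  otherNeighbour? G c d = FP.any? λ y → adj? G c y ×-dec ¬? (y FP.≟ d)

  Pendant : Graph n → Fin n → Fin n → Set
  Pendant G v y = ∀ x → Adj G y x → x ≡ v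

  ¬other⇒pendant : ∀ G {v y} → ¬ OtherNeighbour G y v → Pendant G v y
  ¬other⇒pendant G {v} ¬other x y-x = decidable-stable (x FP.≟ v) (λ x≢v → ¬other (x , y-x , x≢v))

  joins⇒incidentˡ : ∀ {e a b} → Joins e a b → Incident a e
  joins⇒incidentˡ (inj₁ refl) = inj₁ refl
  joins⇒incidentˡ (inj₂ refl) = inj₂ refl

  joins⇒incidentʳ : ∀ {e a b} → Joins e a b → Incident b e
  joins⇒incidentʳ = joins⇒incidentˡ ∘ Sum.swap

  incident-joins : ∀ {e a b c} → Joins e a b → Incident c e → c ≡ a ⊎ c ≡ b
  incident-joins (inj₁ refl) (inj₁ refl) = inj₁ refl
  incident-joins (inj₁ refl) (inj₂ refl) = inj₂ refl
  incident-joins (inj₂ refl) (inj₁ refl) = inj₂ refl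
  incident-joins (inj₂ refl) (inj₂ refl) = inj₁ refl

  incident⇒joins : ∀ {v e} → Incident v e → ∃ (Joins e v)
  incident⇒joins {e = a , b} (inj₁ refl) = b , inj₁ refl
  incident⇒joins {e = a , b} (inj₂ refl) = a , inj₂ refl

  incident²⇒joins : ∀ {x y e} → Incident x e → Incident y e → x ≢ y → Joins e x y
  incident²⇒joins (inj₁ refl) (inj₁ refl) x≢y = ⊥-elim (x≢y refl)
  incident²⇒joins (inj₁ refl) (inj₂ refl) _   = inj₁ refl
  incident²⇒joins (inj₂ refl) (inj₁ refl) _   = inj₂ refl
  incident²⇒joins (inj₂ refl) (inj₂ refl) x≢y = ⊥-elim (x≢y refl)

  joins-≢ : ∀ {e e′ a b c} → Joins e a b → Joins e′ a c → b ≢ c → e ≢ e′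
  joins-≢ (inj₁ refl) (inj₁ refl) b≢c refl = b≢c refl
  joins-≢ (inj₁ refl) (inj₂ refl) b≢c refl = b≢c refl
  joins-≢ (inj₂ refl) (inj₁ refl) b≢c refl = b≢c refl
  joins-≢ (inj₂ refl) (inj₂ refl) b≢c refl = b≢c refl

  joins-distinguishes : ∀ {a b x y} (f : Fin n → ℕ) → Joins (a , b) x y → f x ≢ f y → f a ≢ f b
  joins-distinguishes f (inj₁ refl) fx≢fy = fx≢fy
  joins-distinguishes f (inj₂ refl) fx≢fy = fx≢fy ∘ sym

  adj-sym : (G : Graph n) {a b : Fin n} → Adj G a b → Adj G b a
  adj-sym G = Sum.swap

  edge⇒adj : (G : Graph n) {e : Edge} {a b : Fin n} → e ∈ edges G → Joins e a b → Adj G a b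
  edge⇒adj G e∈ (inj₁ refl) = inj₁ e∈
  edge⇒adj G e∈ (inj₂ refl) = inj₂ e∈

  adj⇒edge : (G : Graph n) {a b : Fin n} → Adj G a b → ∃ λ e → e ∈ edges G × Joins e a b
  adj⇒edge G (inj₁ ab∈) = _ , ab∈ , inj₁ refl
  adj⇒edge G (inj₂ ba∈) = _ , ba∈ , inj₂ refl

  adj-irrefl : (G : Graph n) {a b : Fin n} → Adj G a b → a ≢ b
  adj-irrefl G (inj₁ ab∈) refl = FP.<-irrefl refl (All.lookup (ordered G) ab∈)
  adj-irrefl G (inj₂ ba∈) refl = FP.<-irrefl refl (All.lookup (ordered G) ba∈)

  joins-unique : (G : Graph n) {e e′ : Edge} {a b : Fin n} → e ∈ edges G → e′ ∈ edges G →
    Joins e a b → Joins e′ a b → e ≡ e′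
  joins-unique G _ _ (inj₁ refl) (inj₁ refl) = refl
  joins-unique G _ _ (inj₂ refl) (inj₂ refl) = refl
  joins-unique G e∈ e′∈ (inj₁ refl) (inj₂ refl) =
    ⊥-elim (FP.<-asym (All.lookup (ordered G) e∈) (All.lookup (ordered G) e′∈))
  joins-unique G e∈ e′∈ (inj₂ refl) (inj₁ refl) =
    ⊥-elim (FP.<-asym (All.lookup (ordered G) e∈) (All.lookup (ordered G) e′∈))

  -- The case split of Defs.contrib, so that σ≡weightSum below holds clause by clause.
  incidentWeight : (Edge → ℕ) → Fin n → Edge → ℕ
  incidentWeight ω v e with v FP.≟ proj₁ e | v FP.≟ proj₂ e
  ... | yes _ | _     = ω e
  ... | no _  | yes _ = ω e
  ... | no _  | no _  = 0

  incidentWeight-incident : ∀ ω {v e} → Incident v e → incidentWeight ω v e ≡ ω e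
  incidentWeight-incident ω {v} {e} v∈e with v FP.≟ proj₁ e | v FP.≟ proj₂ e | v∈e
  ... | yes _ | _     | _ = refl
  ... | no _  | yes _ | _ = refl
  ... | no ¬p | no _  | inj₁ p = ⊥-elim (¬p p)
  ... | no _  | no ¬q | inj₂ q = ⊥-elim (¬q q)

  incidentWeight-¬incident : ∀ ω {v e} → ¬ Incident v e → incidentWeight ω v e ≡ 0
  incidentWeight-¬incident ω {v} {e} v∉e with v FP.≟ proj₁ e | v FP.≟ proj₂ e
  ... | yes p | _     = ⊥-elim (v∉e (inj₁ p))
  ... | no _  | yes q = ⊥-elim (v∉e (inj₂ q))
  ... | no _  | no _  = refl

  weightSum : List Edge → (Edge → ℕ) → Fin n → ℕ
  weightSum E ω v = sum (map (incidentWeight ω v) E)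

  weightSum≡sum-incident : ∀ E ω v → weightSum E ω v ≡ sum (map ω (filter (incident? v) E))
  weightSum≡sum-incident E ω v = trans (sum-map-filter (incident? v) (incidentWeight ω v) E)
    (trans (cong₂ _+_
      (sum-map-cong (incidentWeight-incident ω ∘ proj₂ ∘ MP.∈-filter⁻ (incident? v) {xs = E}))
      (sum-map-zero _ (incidentWeight-¬incident ω ∘ proj₂ ∘ MP.∈-filter⁻ (¬? ∘ incident? v) {xs = E})))
      (NP.+-identityʳ _))

  weightSum-only : ∀ E ω {v e} → Unique E → e ∈ E → Incident v e →
    (∀ {e′} → e′ ∈ E → Incident v e′ → e′ ≡ e) → weightSum E ω v ≡ ω e
  weightSum-only E ω {v} u e∈ v∈e only = trans (weightSum≡sum-incident E ω v)
    (sum-map-singleton ω (UniqueP.filter⁺ (incident? v) u) (MP.∈-filter⁺ (incident? v) e∈ v∈e)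
      (λ e′∈ → let e′∈E , v∈e′ = MP.∈-filter⁻ (incident? v) e′∈ in only e′∈E v∈e′))

  weightSum-≥-pair : ∀ E ω {v e e′} → e ∈ E → e′ ∈ E → e ≢ e′ → Incident v e → Incident v e′ →
    ω e + ω e′ ≤ weightSum E ω v
  weightSum-≥-pair E ω {v} e∈ e′∈ e≢e′ v∈e v∈e′ =
    subst (_≤ weightSum E ω v) (cong₂ _+_ (incidentWeight-incident ω v∈e) (incidentWeight-incident ω v∈e′))
      (sum-map-≥-pair (incidentWeight ω v) e∈ e′∈ e≢e′)

  weightSum-pendant : (G : Graph n) (ω : Edge → ℕ) {v y : Fin n} {e : Edge} → e ∈ edges G →
    Joins e v y → Pendant G v y → weightSum (edges G) ω y ≡ ω e
  weightSum-pendant G ω {v} {y} {e} e∈ e-vy pendant =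
    weightSum-only (edges G) ω (nodup G) e∈ (joins⇒incidentʳ e-vy) only
    where
    only : ∀ {e′} → e′ ∈ edges G → Incident y e′ → e′ ≡ e
    only {e′} e′∈ y∈e′ with incident⇒joins y∈e′
    ... | x , e′-yx with pendant x (edge⇒adj G e′∈ e′-yx)
    ...   | refl = joins-unique G e′∈ e∈ e′-yx (Sum.swap e-vy)

  pendant-distinguished : (G : Graph n) (ω : Edge → ℕ) {v y : Fin n} {e e′ : Edge} →
    e ∈ edges G → Joins e v y → Pendant G v y →
    e′ ∈ edges G → e′ ≢ e → Incident v e′ → 0 < ω e′ →
    weightSum (edges G) ω v ≢ weightSum (edges G) ω y
  pendant-distinguished G ω {v} {y} {e} {e′} e∈ e-vy pendant e′∈ e′≢e v∈e′ 0<ωe′ same =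
    NP.<-irrefl (sym same) (begin-strict
      weightSum (edges G) ω y   ≡⟨ weightSum-pendant G ω e∈ e-vy pendant ⟩
      ω e                       ≡⟨ NP.+-identityʳ (ω e) ⟨
      ω e + 0                   <⟨ NP.+-monoʳ-< (ω e) 0<ωe′ ⟩
      ω e + ω e′                ≤⟨ weightSum-≥-pair (edges G) ω e∈ e′∈ (e′≢e ∘ sym)
                                     (joins⇒incidentˡ e-vy) v∈e′ ⟩
      weightSum (edges G) ω v   ∎)
    where open NP.≤-Reasoning

  -- Weights are attached to edges as vertex pairs rather than to indices, so that they survive
  -- the deletion of edges.
  record IsInjectiveNSD (G : Graph n) (W : List ℕ) (ω : Edge → ℕ) : Set where
    field
      ∈W             : ∀ {e} → e ∈ edges G → ω e ∈ W
      injective      : ∀ {e e′} → e ∈ edges G → e′ ∈ edges G → ω e ≡ ω e′ → e ≡ e′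
      distinguishing : ∀ {a b} → (a , b) ∈ edges G →
                       weightSum (edges G) ω a ≢ weightSum (edges G) ω b

  Weightable : Graph n → Set
  Weightable G = ∀ W → Unique W → All (0 <_) W → length W ≡ ∣E∣ G →
    Σ (Edge → ℕ) (IsInjectiveNSD G W)

  remove : {P : Edge → Set} → Decidable P → Graph n → Graph n
  remove P? G = record
    { edges   = filter (¬? ∘ P?) (edges G)
    ; ordered = AllP.filter⁺ (¬? ∘ P?) (ordered G)
    ; nodup   = UniqueP.filter⁺ (¬? ∘ P?) (nodup G)
    }

  forest-⊆ : {G H : Graph n} → (∀ {e} → e ∈ edges H → e ∈ edges G) → Forest G → Forest H
  forest-⊆ H⊆G forest C = forest record
    { k = k ; c = c ; inj = inj ; steps = Sum.map H⊆G H⊆G ∘ steps ; closes = Sum.map H⊆G H⊆G closes }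
    where open Cycle C

  closed-path⇒cycle : {G : Graph n} (a b c : Fin n) (r : List (Fin n)) → Unique (a ∷ b ∷ c ∷ r) →
    Linked (Adj G) (a ∷ b ∷ c ∷ r) → Adj G (lastOf c r) a → Cycle G
  closed-path⇒cycle {G} a b c r u path closing = record
    { k = length r
    ; c = lookup (a ∷ b ∷ c ∷ r)
    ; inj = lookup-injective u
    ; steps = Linked-lookup a (b ∷ c ∷ r) path
    ; closes = subst (λ z → Adj G z a) (sym (lookup-fromℕ a (b ∷ c ∷ r))) closing
    }

  chord⇒cycle : {G : Graph n} {a b y : Fin n} (xs : List (Fin n)) → Unique (a ∷ b ∷ xs) →
    Linked (Adj G) (a ∷ b ∷ xs) → y ∈ xs → Adj G y a → Cycle G
  chord⇒cycle {G} {a} {b} {y} xs u path y∈ y-a with MP.∈-∃++ y∈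
  ... | pre , _ , refl = cycle pre (AllPairs-prefix (a ∷ b ∷ pre) u) (Linked-prefix (a ∷ b ∷ pre) path)
    where
    cycle : ∀ pre → Unique (a ∷ b ∷ pre ++ y ∷ []) → Linked (Adj G) (a ∷ b ∷ pre ++ y ∷ []) → Cycle G
    cycle [] u path = closed-path⇒cycle a b y [] u path y-a
    cycle (q ∷ qs) u path = closed-path⇒cycle a b q (qs ++ y ∷ []) u path
      (subst (λ z → Adj G z a) (sym (lastOf-∷ʳ q qs y)) y-a)

  record PendantStar (G : Graph n) : Set where
    field
      centre anchor leaf : Fin n
      centre-anchor      : Adj G centre anchor
      centre-leaf        : Adj G centre leaf
      leaf≢anchor        : leaf ≢ anchor
      pendant            : ∀ {y} → Adj G centre y → y ≢ anchor → Pendant G centre y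

  -- Grow a path cur , prev , rest greedily into a non-leaf neighbour of cur; the
  -- path stays simple since G is a forest, so this stops within n steps.
  module LongestPath {G : Graph n} (forest : Forest G) where

    Continues : Fin n → Fin n → Fin n → Set
    Continues prev cur y = Adj G cur y × y ≢ prev × OtherNeighbour G y cur

    continues? : ∀ prev cur → Dec (∃ (Continues prev cur))
    continues? prev cur = FP.any? λ y → adj? G cur y ×-dec ¬? (y FP.≟ prev) ×-dec otherNeighbour? G y cur

    extend : (fuel : ℕ) (cur prev : Fin n) (rest : List (Fin n)) →
      Unique (cur ∷ prev ∷ rest) → Linked (Adj G) (cur ∷ prev ∷ rest) →
      n ≤ fuel + length rest → OtherNeighbour G cur prev → PendantStar G
    extend zero _ _ rest u _ n≤ _ = ⊥-elim (NP.<⇒≱ (NP.≤-trans (NP.n≤1+n _) (unique⇒length≤ u)) n≤)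
    extend (suc fuel) cur prev rest u path n≤ (y₀ , cur-y₀ , y₀≢prev) with continues? prev cur
    ... | no stuck = record
      { centre = cur ; anchor = prev ; leaf = y₀
      ; centre-anchor = Linked.head path ; centre-leaf = cur-y₀ ; leaf≢anchor = y₀≢prev
      ; pendant = λ cur-y y≢prev → ¬other⇒pendant G λ other → stuck (_ , cur-y , y≢prev , other)
      }
    ... | yes (y , cur-y , y≢prev , other) with y ∈? rest
      where open DecMembership FP._≟_ using (_∈?_)
    ...   | yes y∈ = ⊥-elim (forest (chord⇒cycle rest u path y∈ (adj-sym G cur-y)))
    ...   | no y∉ = extend fuel y cur (prev ∷ rest) (fresh ∷ u) (adj-sym G cur-y ∷ path)
                      (subst (n ≤_) (sym (NP.+-suc fuel _)) n≤) other
      where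
      fresh : All (y ≢_) (cur ∷ prev ∷ rest)
      fresh = (adj-irrefl G cur-y ∘ sym) All.∷ y≢prev All.∷ AllP.¬Any⇒All¬ rest y∉

    start : ∀ {x y} → Adj G x y → OtherNeighbour G x y → PendantStar G
    start x-y = extend n _ _ [] ((adj-irrefl G x-y All.∷ All.[]) ∷ All.[] ∷ []) (x-y ∷ [-]) (NP.m≤m+n n 0)

  pendantStar : {G : Graph n} → Forest G → Nice G → ∀ {e} → e ∈ edges G → PendantStar G
  pendantStar {G} forest nice {a , b} ab∈ with otherNeighbour? G b a | otherNeighbour? G a b
  ... | yes b-other | _           = LongestPath.start forest (inj₂ ab∈) b-other
  ... | no _        | yes a-other = LongestPath.start forest (inj₁ ab∈) a-other
  ... | no ¬b-other | no ¬a-other =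
    ⊥-elim (nice ((a , b) , ab∈ , ¬other⇒pendant G ¬a-other , ¬other⇒pendant G ¬b-other))

module Removal {n : ℕ} (G : Graph n) (v : Fin n) {P : Edge → Set} (P? : Decidable P)
  (P⇒pendant : ∀ {e} → e ∈ edges G → P e → ∃ λ y → Joins e v y × Pendant G v y) where

  removed : List Edge
  removed = filter P? (edges G)

  G′ : Graph n
  G′ = remove P? G

  ∈-removed⁻ : ∀ {e} → e ∈ removed → e ∈ edges G × P e
  ∈-removed⁻ = MP.∈-filter⁻ P?

  ∈-removed⁺ : ∀ {e} → e ∈ edges G → P e → e ∈ removed
  ∈-removed⁺ = MP.∈-filter⁺ P?

  ∈-G′⁻ : ∀ {e} → e ∈ edges G′ → e ∈ edges G × ¬ P e
  ∈-G′⁻ = MP.∈-filter⁻ (¬? ∘ P?)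

  ∈-G′⁺ : ∀ {e} → e ∈ edges G → ¬ P e → e ∈ edges G′
  ∈-G′⁺ = MP.∈-filter⁺ (¬? ∘ P?)

  ∣E∣-split : ∣E∣ G ≡ length removed + ∣E∣ G′
  ∣E∣-split = length-filter-split P? (edges G)

  G′-smaller : ∀ {e} → e ∈ edges G → P e → ∣E∣ G′ < ∣E∣ G
  G′-smaller e∈ Pe = LP.filter-notAll (¬? ∘ P?) (edges G) (lose e∈ (λ ¬Pe → ¬Pe Pe))

  forest-G′ : Forest G → Forest G′
  forest-G′ = forest-⊆ (proj₁ ∘ ∈-G′⁻)

  removed-avoids : ∀ {x d e} → x ≢ v → Adj G x d → d ≢ v → e ∈ edges G → P e → ¬ Incident x e
  removed-avoids x≢v x-d d≢v e∈ Pe x∈e with P⇒pendant e∈ Pe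
  ... | y , e-vy , pendant with incident-joins e-vy x∈e
  ...   | inj₁ x≡v = x≢v x≡v
  ...   | inj₂ refl = d≢v (pendant _ x-d)

  adj-G′ : ∀ {a b} → a ≢ v → Adj G a b → b ≢ v → ∀ x → Adj G a x → Adj G′ a x
  adj-G′ a≢v a-b b≢v x a-x with adj⇒edge G a-x
  ... | e , e∈ , e-ax with P? e
  ...   | no ¬Pe = edge⇒adj G′ (∈-G′⁺ e∈ ¬Pe) e-ax
  ...   | yes Pe = ⊥-elim (removed-avoids a≢v a-b b≢v e∈ Pe (joins⇒incidentˡ e-ax))

  nice-G′ : Nice G →
    (∀ {a b} → (a , b) ∈ edges G′ → Pendant G′ b a → Pendant G′ a b → Incident v (a , b) → ⊥) →
    Nice G′
  nice-G′ nice isolated-at-v ((a , b) , ab∈ , a-pendant , b-pendant) with incident? v (a , b)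
  ... | yes v∈ab = isolated-at-v ab∈ a-pendant b-pendant v∈ab
  ... | no v∉ab = nice ((a , b) , ab∈G
      , (λ x a-x → a-pendant x (adj-G′ a≢v (inj₁ ab∈G) b≢v x a-x))
      , (λ x b-x → b-pendant x (adj-G′ b≢v (inj₂ ab∈G) a≢v x b-x)))
    where
    ab∈G : (a , b) ∈ edges G
    ab∈G = proj₁ (∈-G′⁻ ab∈)
    a≢v : a ≢ v
    a≢v = v∉ab ∘ inj₁ ∘ sym
    b≢v : b ≢ v
    b≢v = v∉ab ∘ inj₂ ∘ sym

  module Combine {W : List ℕ} (π : Partition W (length removed) (∣E∣ G′)) (ω′ : Edge → ℕ)
    (good′ : IsInjectiveNSD G′ (Partition.rest π) ω′) where

    open Partition π
    private module good′ = IsInjectiveNSD good′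

    ω : Edge → ℕ
    ω e with P? e
    ... | yes _ = assign _≟ₑ_ removed part e
    ... | no _  = ω′ e

    ω-removed : ∀ {e} → P e → ω e ≡ assign _≟ₑ_ removed part e
    ω-removed {e} Pe with P? e
    ... | yes _  = refl
    ... | no ¬Pe = ⊥-elim (¬Pe Pe)

    ω-kept : ∀ {e} → ¬ P e → ω e ≡ ω′ e
    ω-kept {e} ¬Pe with P? e
    ... | yes Pe = ⊥-elim (¬Pe Pe)
    ... | no _   = refl

    ω-∈ : ∀ {e} → e ∈ edges G → (P e × ω e ∈ part) ⊎ (¬ P e × ω e ∈ rest)
    ω-∈ {e} e∈ with P? e
    ... | yes Pe  = inj₁ (Pe , assign-∈ _≟ₑ_ removed part (sym length-part) (∈-removed⁺ e∈ Pe))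
    ... | no ¬Pe  = inj₂ (¬Pe , good′.∈W (∈-G′⁺ e∈ ¬Pe))

    ∈W : ∀ {e} → e ∈ edges G → ω e ∈ W
    ∈W e∈ = Sum.[ part⊆W ∘ proj₂ , rest⊆W ∘ proj₂ ] (ω-∈ e∈)

    injective : ∀ {e e′} → e ∈ edges G → e′ ∈ edges G → ω e ≡ ω e′ → e ≡ e′
    injective e∈ e′∈ same with ω-∈ e∈ | ω-∈ e′∈
    ... | inj₁ (Pe , _) | inj₁ (Pe′ , _) =
      assign-injective _≟ₑ_ removed part unique-part (sym length-part)
        (∈-removed⁺ e∈ Pe) (∈-removed⁺ e′∈ Pe′) (trans (sym (ω-removed Pe)) (trans same (ω-removed Pe′)))
    ... | inj₁ (_ , ωe∈) | inj₂ (_ , ωe′∈) = ⊥-elim (disjoint ωe∈ ωe′∈ same)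
    ... | inj₂ (_ , ωe∈) | inj₁ (_ , ωe′∈) = ⊥-elim (disjoint ωe′∈ ωe∈ (sym same))
    ... | inj₂ (¬Pe , _) | inj₂ (¬Pe′ , _) =
      good′.injective (∈-G′⁺ e∈ ¬Pe) (∈-G′⁺ e′∈ ¬Pe′) (trans (sym (ω-kept ¬Pe)) (trans same (ω-kept ¬Pe′)))

    weightSum-split : ∀ x → weightSum (edges G) ω x ≡ weightSum removed ω x + weightSum (edges G′) ω′ x
    weightSum-split x = trans (sum-map-filter P? (incidentWeight ω x) (edges G))
      (cong (weightSum removed ω x +_) (sum-map-cong same))
      where
      same : ∀ {e} → e ∈ edges G′ → incidentWeight ω x e ≡ incidentWeight ω′ x e
      same {e} e∈ with incident? x e
      ... | yes x∈e = trans (incidentWeight-incident ω x∈e)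
                        (trans (ω-kept (proj₂ (∈-G′⁻ e∈))) (sym (incidentWeight-incident ω′ x∈e)))
      ... | no x∉e = trans (incidentWeight-¬incident ω x∉e) (sym (incidentWeight-¬incident ω′ x∉e))

    weightSum-removed-centre : weightSum removed ω v ≡ sum part
    weightSum-removed-centre = trans (sum-map-cong at-centre)
      (sum-map-assign _≟ₑ_ removed part (UniqueP.filter⁺ P? (nodup G)) (sym length-part))
      where
      at-centre : ∀ {e} → e ∈ removed → incidentWeight ω v e ≡ assign _≟ₑ_ removed part e
      at-centre e∈ with ∈-removed⁻ e∈
      ... | e∈G , Pe = trans (incidentWeight-incident ω (joins⇒incidentˡ (proj₁ (proj₂ (P⇒pendant e∈G Pe)))))
                             (ω-removed Pe)

    weightSum-removed-away : ∀ {x d} → x ≢ v → Adj G x d → d ≢ v → weightSum removed ω x ≡ 0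
    weightSum-removed-away x≢v x-d d≢v = sum-map-zero _ λ e∈ →
      let e∈G , Pe = ∈-removed⁻ e∈ in incidentWeight-¬incident ω (removed-avoids x≢v x-d d≢v e∈G Pe)

    distinguishing-away : ∀ {a b} → (a , b) ∈ edges G′ → ¬ Incident v (a , b) →
      weightSum (edges G) ω a ≢ weightSum (edges G) ω b
    distinguishing-away {a} {b} ab∈ v∉ab same = good′.distinguishing ab∈ (begin
      weightSum (edges G′) ω′ a   ≡⟨ kept a≢v (inj₁ ab∈G) b≢v ⟨
      weightSum (edges G) ω a     ≡⟨ same ⟩
      weightSum (edges G) ω b     ≡⟨ kept b≢v (inj₂ ab∈G) a≢v ⟩
      weightSum (edges G′) ω′ b   ∎)
      where
      open ≡-Reasoning
      a≢v : a ≢ v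
      a≢v = v∉ab ∘ inj₁ ∘ sym
      b≢v : b ≢ v
      b≢v = v∉ab ∘ inj₂ ∘ sym
      ab∈G : (a , b) ∈ edges G
      ab∈G = proj₁ (∈-G′⁻ ab∈)
      kept : ∀ {x d} → x ≢ v → Adj G x d → d ≢ v → weightSum (edges G) ω x ≡ weightSum (edges G′) ω′ x
      kept {x} x≢v x-d d≢v =
        trans (weightSum-split x) (cong (_+ weightSum (edges G′) ω′ x) (weightSum-removed-away x≢v x-d d≢v))

    distinguishing-removed : All (0 <_) W → ∀ {a b e′} → (a , b) ∈ edges G → P (a , b) →
      e′ ∈ edges G → e′ ≢ (a , b) → Incident v e′ → weightSum (edges G) ω a ≢ weightSum (edges G) ω b
    distinguishing-removed positive ab∈ Pab e′∈ e′≢ab v∈e′ with P⇒pendant ab∈ Pab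
    ... | y , ab-vy , pendant = joins-distinguishes (weightSum (edges G) ω) ab-vy
      (pendant-distinguished G ω ab∈ ab-vy pendant e′∈ e′≢ab v∈e′ (All.lookup positive (∈W e′∈)))

module _ {n : ℕ} where

  SmallerWeightable : Graph n → Set
  SmallerWeightable G = ∀ {H : Graph n} → ∣E∣ H < ∣E∣ G → Forest H → Nice H → Weightable H

  positive-⊆ : ∀ {W W′ : List ℕ} → All (0 <_) W → (∀ {x} → x ∈ W′ → x ∈ W) → All (0 <_) W′
  positive-⊆ positive W′⊆W = All.tabulate (λ x∈ → All.lookup positive (W′⊆W x∈))

  module Star (G : Graph n) (forest : Forest G) (nice : Nice G) (s : PendantStar G)
    (anchor-pendant : Pendant G (PendantStar.centre s) (PendantStar.anchor s))
    (IH : SmallerWeightable G) where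

    open PendantStar s

    star : ∀ {e} → e ∈ edges G → Incident centre e → ∃ λ y → Joins e centre y × Pendant G centre y
    star e∈ c∈e with incident⇒joins c∈e
    ... | y , e-cy with y FP.≟ anchor
    ...   | yes refl     = y , e-cy , anchor-pendant
    ...   | no y≢anchor  = y , e-cy , pendant (edge⇒adj G e∈ e-cy) y≢anchor

    open Removal G centre (incident? centre) star

    nice′ : Nice G′
    nice′ = nice-G′ nice λ ab∈ _ _ → proj₂ (∈-G′⁻ ab∈)

    weightable : Weightable G
    weightable W uW positive ∣W∣ = ω , record
      { ∈W = ∈W ; injective = injective ; distinguishing = distinguishing }
      where
      π : Partition W (length removed) (∣E∣ G′)
      π = lower-partition (split uW (length removed) (∣E∣ G′) (trans ∣W∣ ∣E∣-split))
      open Partition π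
      anchor-edge : ∃ λ e → e ∈ edges G × Joins e centre anchor
      anchor-edge = adj⇒edge G centre-anchor
      leaf-edge : ∃ λ e → e ∈ edges G × Joins e centre leaf
      leaf-edge = adj⇒edge G centre-leaf
      rec : Σ (Edge → ℕ) (IsInjectiveNSD G′ rest)
      rec = IH (G′-smaller (proj₁ (proj₂ anchor-edge)) (joins⇒incidentˡ (proj₂ (proj₂ anchor-edge))))
               (forest-G′ forest) nice′ rest unique-rest (positive-⊆ positive rest⊆W) length-rest
      open Combine π (proj₁ rec) (proj₂ rec)

      distinguishing : ∀ {a b} → (a , b) ∈ edges G → weightSum (edges G) ω a ≢ weightSum (edges G) ω b
      distinguishing {a} {b} ab∈ with incident? centre (a , b)
      ... | no c∉ab = distinguishing-away (∈-G′⁺ ab∈ c∉ab) c∉ab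
      ... | yes c∈ab with incident⇒joins c∈ab
      ...   | y , ab-cy with y FP.≟ anchor
      ...     | yes refl = let e , e∈ , e-cl = leaf-edge in
        distinguishing-removed positive ab∈ c∈ab e∈ (joins-≢ e-cl ab-cy leaf≢anchor) (joins⇒incidentˡ e-cl)
      ...     | no y≢anchor = let e , e∈ , e-ca = anchor-edge in
        distinguishing-removed positive ab∈ c∈ab e∈ (joins-≢ e-ca ab-cy (y≢anchor ∘ sym))
          (joins⇒incidentˡ e-ca)

  module Anchored (G : Graph n) (forest : Forest G) (nice : Nice G) (s : PendantStar G)
    (anchor-branches : OtherNeighbour G (PendantStar.anchor s) (PendantStar.centre s))
    (IH : SmallerWeightable G) where

    open PendantStar s

    LeafEdge : Edge → Set
    LeafEdge e = Incident centre e × ¬ Incident anchor e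

    leafEdge? : Decidable LeafEdge
    leafEdge? e = incident? centre e ×-dec ¬? (incident? anchor e)

    leafEdge-pendant : ∀ {e} → e ∈ edges G → LeafEdge e → ∃ λ y → Joins e centre y × Pendant G centre y
    leafEdge-pendant e∈ (c∈e , a∉e) with incident⇒joins c∈e
    ... | y , e-cy = y , e-cy , pendant (edge⇒adj G e∈ e-cy) λ { refl → a∉e (joins⇒incidentʳ e-cy) }

    open Removal G centre leafEdge? leafEdge-pendant

    centre≢anchor : centre ≢ anchor
    centre≢anchor = adj-irrefl G centre-anchor

    t : Fin n
    t = proj₁ anchor-branches

    anchor-t : Adj G anchor t
    anchor-t = proj₁ (proj₂ anchor-branches)

    t≢centre : t ≢ centre
    t≢centre = proj₂ (proj₂ anchor-branches)

    anchor-t′ : Adj G′ anchor t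
    anchor-t′ = adj-G′ (centre≢anchor ∘ sym) anchor-t t≢centre t anchor-t

    stem : Edge
    stem = proj₁ (adj⇒edge G centre-anchor)

    stem∈ : stem ∈ edges G
    stem∈ = proj₁ (proj₂ (adj⇒edge G centre-anchor))

    stem-ca : Joins stem centre anchor
    stem-ca = proj₂ (proj₂ (adj⇒edge G centre-anchor))

    stem∈G′ : stem ∈ edges G′
    stem∈G′ = ∈-G′⁺ stem∈ λ (_ , a∉stem) → a∉stem (joins⇒incidentʳ stem-ca)

    only-stem-at-centre : ∀ {e} → e ∈ edges G′ → Incident centre e → e ≡ stem
    only-stem-at-centre {e} e∈ c∈e =
      joins-unique G e∈G stem∈ (incident²⇒joins c∈e a∈e centre≢anchor) stem-ca
      where
      e∈G : e ∈ edges G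
      e∈G = proj₁ (∈-G′⁻ e∈)
      a∈e : Incident anchor e
      a∈e = decidable-stable (incident? anchor e) (proj₂ (∈-G′⁻ e∈) ∘ (c∈e ,_))

    at-centre⇒joins-anchor : ∀ {e} → e ∈ edges G′ → Incident centre e → Joins e centre anchor
    at-centre⇒joins-anchor e∈ c∈e = subst (λ e → Joins e centre anchor) (sym (only-stem-at-centre e∈ c∈e)) stem-ca

    nice′ : Nice G′
    nice′ = nice-G′ nice isolated
      where
      isolated : ∀ {a b} → (a , b) ∈ edges G′ → Pendant G′ b a → Pendant G′ a b →
        Incident centre (a , b) → ⊥
      isolated ab∈ a-pendant b-pendant c∈ab with at-centre⇒joins-anchor ab∈ c∈ab
      ... | inj₁ refl = t≢centre (b-pendant t anchor-t′)
      ... | inj₂ refl = t≢centre (a-pendant t anchor-t′)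

    leaf-edge : ∃ λ e → e ∈ edges G × LeafEdge e
    leaf-edge with adj⇒edge G centre-leaf
    ... | e , e∈ , e-cl = e , e∈ , joins⇒incidentˡ e-cl ,
      λ a∈e → Sum.[ centre≢anchor ∘ sym , leaf≢anchor ∘ sym ] (incident-joins e-cl a∈e)

    k : ℕ
    k = length removed

    0<k : 0 < k
    0<k = let _ , e∈ , e-leaf = leaf-edge in LP.filter-some leafEdge? (lose e∈ e-leaf)

    anchor-others : List Edge
    anchor-others = filter (¬? ∘ (_≟ₑ stem)) (filter (incident? anchor) (edges G′))

    d : ℕ
    d = length anchor-others

    module Weighting {W : List ℕ} (positive : All (0 <_) W) (π : Partition W k (∣E∣ G′))
      (separated : ∀ B → (∀ {x} → x ∈ B → x ∈ Partition.rest π) → length B ≡ d →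
                   sum (Partition.part π) ≢ sum B) where

      open Partition π

      rec : Σ (Edge → ℕ) (IsInjectiveNSD G′ rest)
      rec = IH (G′-smaller (proj₁ (proj₂ leaf-edge)) (proj₂ (proj₂ leaf-edge)))
               (forest-G′ forest) nice′ rest unique-rest (positive-⊆ positive rest⊆W) length-rest

      ω′ : Edge → ℕ
      ω′ = proj₁ rec

      open Combine π ω′ (proj₂ rec) public

      weightSum-centre : weightSum (edges G) ω centre ≡ sum part + ω′ stem
      weightSum-centre = trans (weightSum-split centre) (cong₂ _+_ weightSum-removed-centre
        (weightSum-only (edges G′) ω′ (nodup G′) stem∈G′ (joins⇒incidentˡ stem-ca) only-stem-at-centre))

      weightSum-anchor : weightSum (edges G) ω anchor ≡ ω′ stem + sum (map ω′ anchor-others)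
      weightSum-anchor = begin
        weightSum (edges G) ω anchor
          ≡⟨ weightSum-split anchor ⟩
        weightSum removed ω anchor + weightSum (edges G′) ω′ anchor
          ≡⟨ cong (_+ weightSum (edges G′) ω′ anchor)
                  (weightSum-removed-away (centre≢anchor ∘ sym) anchor-t t≢centre) ⟩
        weightSum (edges G′) ω′ anchor
          ≡⟨ weightSum≡sum-incident (edges G′) ω′ anchor ⟩
        sum (map ω′ at-anchor)
          ≡⟨ sum-map-filter (_≟ₑ stem) ω′ at-anchor ⟩
        sum (map ω′ (filter (_≟ₑ stem) at-anchor)) + sum (map ω′ anchor-others)
          ≡⟨ cong (_+ sum (map ω′ anchor-others)) (sum-map-singleton ω′
               (UniqueP.filter⁺ (_≟ₑ stem) (UniqueP.filter⁺ (incident? anchor) (nodup G′)))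
               (MP.∈-filter⁺ (_≟ₑ stem) (MP.∈-filter⁺ (incident? anchor) stem∈G′ (joins⇒incidentʳ stem-ca)) refl)
               (proj₂ ∘ MP.∈-filter⁻ (_≟ₑ stem) {xs = at-anchor})) ⟩
        ω′ stem + sum (map ω′ anchor-others) ∎
        where
        open ≡-Reasoning
        at-anchor : List Edge
        at-anchor = filter (incident? anchor) (edges G′)

      centre-anchor-distinguished : weightSum (edges G) ω centre ≢ weightSum (edges G) ω anchor
      centre-anchor-distinguished same =
        separated (map ω′ anchor-others) others⊆rest (LP.length-map ω′ anchor-others)
          (NP.+-cancelʳ-≡ (ω′ stem) _ _ (begin
            sum part + ω′ stem                     ≡⟨ weightSum-centre ⟨
            weightSum (edges G) ω centre           ≡⟨ same ⟩
            weightSum (edges G) ω anchor           ≡⟨ weightSum-anchor ⟩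
            ω′ stem + sum (map ω′ anchor-others)   ≡⟨ NP.+-comm (ω′ stem) _ ⟩
            sum (map ω′ anchor-others) + ω′ stem   ∎))
        where
        open ≡-Reasoning
        others⊆rest : ∀ {x} → x ∈ map ω′ anchor-others → x ∈ rest
        others⊆rest x∈ with MP.∈-map⁻ ω′ x∈
        ... | e , e∈ , refl = IsInjectiveNSD.∈W (proj₂ rec)
          (proj₁ (MP.∈-filter⁻ (incident? anchor) (proj₁ (MP.∈-filter⁻ (¬? ∘ (_≟ₑ stem)) e∈))))

      distinguishing : ∀ {a b} → (a , b) ∈ edges G → weightSum (edges G) ω a ≢ weightSum (edges G) ω b
      distinguishing {a} {b} ab∈ with leafEdge? (a , b)
      ... | yes ab-leafEdge = distinguishing-removed positive ab∈ ab-leafEdge stem∈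
        (λ stem≡ab → proj₂ ab-leafEdge (subst (Incident anchor) stem≡ab (joins⇒incidentʳ stem-ca)))
        (joins⇒incidentˡ stem-ca)
      ... | no ¬leafEdge with incident? centre (a , b)
      ...   | yes c∈ab = joins-distinguishes (weightSum (edges G) ω)
        (at-centre⇒joins-anchor (∈-G′⁺ ab∈ ¬leafEdge) c∈ab) centre-anchor-distinguished
      ...   | no c∉ab = distinguishing-away (∈-G′⁺ ab∈ ¬leafEdge) c∉ab

      good : IsInjectiveNSD G W ω
      good = record { ∈W = ∈W ; injective = injective ; distinguishing = distinguishing }

    -- The k leaf-edge weights are taken smallest if k ≤ d and largest otherwise, so that their sum
    -- differs from any sum of d of the remaining weights.
    weightable : Weightable G
    weightable W uW positive ∣W∣ with k ≤? d
    ... | yes k≤d = ω , good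
      where
      sp : Split W k (∣E∣ G′)
      sp = split uW k (∣E∣ G′) (trans ∣W∣ ∣E∣-split)
      open Split sp
      separated : ∀ B → (∀ {x} → x ∈ B → x ∈ upper) → length B ≡ d → sum lower ≢ sum B
      separated B B⊆ ∣B∣ = NP.<⇒≢ (sum-< lower B (subst₂ _≤_ (sym length-lower) (sym ∣B∣) k≤d)
        (λ x∈ y∈ → lower<upper x∈ (B⊆ y∈)) (positive-⊆ positive (upper⊆W ∘ B⊆))
        (subst (0 <_) (sym ∣B∣) (NP.<-≤-trans 0<k k≤d)))
      open Weighting positive (lower-partition sp) separated
    ... | no k≰d = ω , good
      where
      sp : Split W (∣E∣ G′) k
      sp = split uW (∣E∣ G′) k (trans ∣W∣ (trans ∣E∣-split (NP.+-comm k (∣E∣ G′))))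
      open Split sp
      separated : ∀ B → (∀ {x} → x ∈ B → x ∈ lower) → length B ≡ d → sum upper ≢ sum B
      separated B B⊆ ∣B∣ = NP.>⇒≢ (sum-< B upper
        (subst₂ _≤_ (sym ∣B∣) (sym length-upper) (NP.<⇒≤ (NP.≰⇒> k≰d)))
        (λ x∈ y∈ → lower<upper (B⊆ x∈) y∈) (positive-⊆ positive upper⊆W)
        (subst (0 <_) (sym length-upper) 0<k))
      open Weighting positive (upper-partition sp) separated

module _ {n : ℕ} where

  weightable-via-star : (G : Graph n) → Forest G → Nice G → SmallerWeightable G → PendantStar G → Weightable G
  weightable-via-star G forest nice IH s with otherNeighbour? G (PendantStar.anchor s) (PendantStar.centre s)
  ... | yes branches = Anchored.weightable G forest nice s branches IH
  ... | no ¬branches = Star.weightable G forest nice s (¬other⇒pendant G ¬branches) IH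

  forest-weightable : (G : Graph n) → Forest G → Nice G → Weightable G
  forest-weightable = WF.All.wfRec (On.wellFounded ∣E∣ <-wellFounded) 0ℓ
    (λ G → Forest G → Nice G → Weightable G) step
    where
    step : (G : Graph n) → SmallerWeightable G → Forest G → Nice G → Weightable G
    step record { edges = [] } _ _ _ _ _ _ _ =
      (λ _ → 0) , record { ∈W = λ () ; injective = λ () ; distinguishing = λ () }
    step G@record { edges = _ ∷ _ } IH forest nice =
      weightable-via-star G forest nice IH (pendantStar forest nice (here refl))

  σ≡weightSum : (G : Graph n) (ω : Edge → ℕ) (x : Fin n) → σ G (ω ∘ edge G) x ≡ weightSum (edges G) ω x
  σ≡weightSum G ω x = cong sum (begin
    tabulate (contrib G (ω ∘ edge G) x)                    ≡⟨ LP.tabulate-cong contrib≗ ⟩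
    tabulate (incidentWeight ω x ∘ lookup (edges G))       ≡⟨ LP.map-tabulate (lookup (edges G)) (incidentWeight ω x) ⟨
    map (incidentWeight ω x) (tabulate (lookup (edges G))) ≡⟨ cong (map (incidentWeight ω x)) (LP.tabulate-lookup (edges G)) ⟩
    map (incidentWeight ω x) (edges G)                     ∎)
    where
    open ≡-Reasoning
    contrib≗ : ∀ i → contrib G (ω ∘ edge G) x i ≡ incidentWeight ω x (edge G i)
    contrib≗ i with x FP.≟ proj₁ (edge G i) | x FP.≟ proj₂ (edge G i)
    ... | yes _ | _     = refl
    ... | no _  | yes _ = refl
    ... | no _  | no _  = refl

  IsInjectiveNSD⇒indexed : {G : Graph n} {W : List ℕ} {ω : Edge → ℕ} → IsInjectiveNSD G W ω →
    UsesWeights G W (ω ∘ edge G) × EdgeInjective G (ω ∘ edge G) × NeighbourSumDistinguishing G (ω ∘ edge G)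
  IsInjectiveNSD⇒indexed {G} {ω = ω} good =
    (λ i → ∈W (MP.∈-lookup i)) ,
    (λ {i} {j} same → lookup-injective (nodup G) (injective (MP.∈-lookup i) (MP.∈-lookup j) same)) ,
    (λ i same → distinguishing (MP.∈-lookup i)
      (trans (sym (σ≡weightSum G ω (proj₁ (edge G i)))) (trans same (σ≡weightSum G ω (proj₂ (edge G i))))))
    where open IsInjectiveNSD good

injective-weighting-bound : ∀ {n} (G : Graph n) {k : ℕ} {w : Weighting G} →
  IsKWeighting G k w → EdgeInjective G w → ∣E∣ G ≤ k
injective-weighting-bound G {k} {w} bounded inj = FP.injective⇒≤ slot-injective
  where
  pred< : ∀ {a} → 1 ≤ a × a ≤ k → a ∸ 1 < k
  pred< {suc a} (_ , a<k) = a<k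
  slot : Fin (∣E∣ G) → Fin k
  slot e = fromℕ< (pred< (bounded e))
  slot-injective : ∀ {i j} → slot i ≡ slot j → i ≡ j
  slot-injective {i} {j} same = inj (NP.∸-cancelʳ-≡ (proj₁ (bounded i)) (proj₁ (bounded j))
    (trans (sym (FP.toℕ-fromℕ< _)) (trans (cong toℕ same) (FP.toℕ-fromℕ< _))))

oneTo : ℕ → List ℕ
oneTo m = map suc (upTo m)

oneTo-unique : ∀ m → Unique (oneTo m)
oneTo-unique m = UniqueP.map⁺ NP.suc-injective (UniqueP.upTo⁺ m)

length-oneTo : ∀ m → length (oneTo m) ≡ m
length-oneTo m = trans (LP.length-map suc (upTo m)) (LP.length-upTo m)

∈-oneTo⁻ : ∀ {m x} → x ∈ oneTo m → 1 ≤ x × x ≤ m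
∈-oneTo⁻ x∈ with MP.∈-map⁻ suc x∈
... | _ , y∈ , refl = s≤s z≤n , MP.∈-upTo⁻ y∈

theorem3p3 : ∀ {n} (F : Graph n) → Forest F → Nice F →
    (∀ (W : List ℕ) → Unique W → All (0 <_) W → length W ≡ ∣E∣ F →
    Σ (Weighting F) λ w →
    UsesWeights F W w × EdgeInjective F w × NeighbourSumDistinguishing F w)
    × IsChiE1 F (∣E∣ F)
theorem3p3 F forest nice = every-weight-set , consecutive , minimal
  where
  every-weight-set : ∀ W → Unique W → All (0 <_) W → length W ≡ ∣E∣ F → Σ (Weighting F) λ w →
    UsesWeights F W w × EdgeInjective F w × NeighbourSumDistinguishing F w
  every-weight-set W uW positive ∣W∣ =
    let ω , good = forest-weightable F forest nice W uW positive ∣W∣ in ω ∘ edge F , IsInjectiveNSD⇒indexed good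

  consecutive : AdmitsEI-NSD F (∣E∣ F)
  consecutive with every-weight-set (oneTo (∣E∣ F)) (oneTo-unique _)
    (All.tabulate (proj₁ ∘ ∈-oneTo⁻)) (length-oneTo _)
  ... | w , uses , inj , nsd = w , ∈-oneTo⁻ ∘ uses , inj , nsd

  minimal : ∀ k → k < ∣E∣ F → ¬ AdmitsEI-NSD F k
  minimal k k<∣E∣ (w , bounded , inj , _) = NP.<⇒≱ k<∣E∣ (injective-weighting-bound F bounded inj)
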